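{- For all $n\in\mathbb{N}$ and $\pi\in S_n'$, the function $T_\pi:[n]\to D(\alpha_\pi)$ is a bijection.
   Context: A "permutation" may be any finite sequence of distinct integers. West's stack-sorting map $s$: read the input left to right with an initially empty stack; repeatedly, if the input is nonempty and either the stack is empty or the top of the stack is greater than the next input entry, push the next entry; otherwise pop the top of the stack and append it to the output; stop when input and stack are empty. $\operatorname{sc}(\pi)$ is the least $k\ge0$ with $s^k(\pi)$ increasing. $S_n'$ is the set of permutations of $\{0,1,\dots,n\}$ whose last entry is $0$. For $\pi\in S_n'$ and $1\le i\le\operatorname{sc}(\pi)$ let $\sigma=s^{i-1}(\pi)$. Let $c_{\pi,i,1}$ be the maximum of the entries of $\sigma$ strictly left of $0$; for $j\ge2$, as long as some entry of $\sigma$ lies strictly between $c_{\pi,i,j-1}$ and $0$, let $c_{\pi,i,j}$ be the maximum of those entries; otherwise stop. This gives $C_{\pi,i}=(c_{\pi,i,1},\dots,c_{\pi,i,|C_{\pi,i}|})$. Blocks: $b_{\pi,i,1}$ is the contiguous subsequence of $\sigma$ strictly before $c_{\pi,i,1}$, and $b_{\pi,i,j}$ ($j\ge2$) the contiguous subsequence strictly between $c_{\pi,i,j-1}$ and $c_{\pi,i,j}$. Every $x\in[n]$ equals $c_{\pi,i,j}$ for a unique pair $(i,j)$; set $\operatorname{col}_\pi(x)=i$, $\operatorname{colpos}_\pi(x)=j$. If $\operatorname{col}_\pi(x)>1$, there is a unique $j$ with $x=\max(b_{\pi,\operatorname{col}_\pi(x)-1,j})$, and $\operatorname{leftof}_\pi(x):=c_{\pi,\operatorname{col}_\pi(x)-1,j}$.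 Recursively $\operatorname{row}_\pi(x)=\operatorname{colpos}_\pi(x)$ if $\operatorname{col}_\pi(x)=1$, and $\operatorname{row}_\pi(x)=\operatorname{row}_\pi(\operatorname{leftof}_\pi(x))$ otherwise. The composition $\alpha_\pi=(|\{x\in[n]:\operatorname{row}_\pi(x)=j\}|)_{j=1}^{|C_{\pi,1}|}$. For a composition $\alpha=(\alpha_1,\dots,\alpha_k)$, $D(\alpha)=\{(i,j)\in\mathbb{N}^2: 1\le j\le k,\ i\le\alpha_j\}$. The stack-sorting tableau is $T_\pi:[n]\to D(\alpha_\pi)$, $T_\pi(x)=(\operatorname{col}_\pi(x),\operatorname{row}_\pi(x))$. -}

module Defs where

open import Data.Nat using (ℕ; zero; suc; _∸_; _≤_; _⊔_; _<ᵇ_; _≤ᵇ_; _≡ᵇ_)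
open import Data.Bool using (Bool; true; false; if_then_else_; _∧_)
open import Data.List using (List; []; _∷_; _++_; [_]; length; map; upTo; filterᵇ; foldr)
open import Data.Maybe using (Maybe; just; nothing)
open import Data.Product using (_×_; _,_; proj₁; proj₂; ∃)
open import Relation.Binary.PropositionalEquality using (_≡_)
open import Data.List.Relation.Binary.Permutation.Propositional using (_↭_)

-- West's stack-sorting map (stack as a list, head = top)

popWhile : ℕ → List ℕ → List ℕ × List ℕ
popWhile x [] = [] , []
popWhile x (t ∷ st) with x <ᵇ t
... | true  = [] , t ∷ st
... | false with popWhile x st
...   | p , r = t ∷ p , r

stackGo : List ℕ → List ℕ → List ℕ
stackGo [] st = st
stackGo (x ∷ xs) st with popWhile x st
... | p , r = p ++ stackGo xs (x ∷ r)

s : List ℕ → List ℕ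
s π = stackGo π []

iter : {A : Set} → ℕ → (A → A) → A → A
iter zero f a = a
iter (suc k) f a = f (iter k f a)

isIncreasing : List ℕ → Bool
isIncreasing [] = true
isIncreasing (x ∷ []) = true
isIncreasing (x ∷ y ∷ xs) = (x <ᵇ y) ∧ isIncreasing (y ∷ xs)

scFrom : ℕ → ℕ → List ℕ → ℕ
scFrom zero k σ = k
scFrom (suc f) k σ = if isIncreasing σ then k else scFrom f (suc k) (s σ)

-- sc(π); a permutation of length m is sorted by m - 1 passes, so fuel m suffices
sc : List ℕ → ℕ
sc π = scFrom (length π) 0 π

breakAt : ℕ → List ℕ → List ℕ × List ℕ
breakAt v [] = [] , []
breakAt v (x ∷ xs) with x ≡ᵇ v
... | true = [] , xs
... | false with breakAt v xs
...   | b , a = x ∷ b , a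

maxL : List ℕ → ℕ
maxL = foldr _⊔_ 0

isNonEmpty : List ℕ → Bool
isNonEmpty [] = false
isNonEmpty (_ ∷ _) = true

-- Given L = the entries of σ strictly left of 0: c₁ = max L, then c_j = max of
-- the entries between c_{j-1} and 0, etc.  Returns the pairs (b_j , c_j).
decompF : ℕ → List ℕ → List (List ℕ × ℕ)
decompF zero L = []
decompF (suc f) [] = []
decompF (suc f) (y ∷ ys) with breakAt (maxL (y ∷ ys)) (y ∷ ys)
... | b , a = (b , maxL (y ∷ ys)) ∷ decompF f a

decomp : List ℕ → List (List ℕ × ℕ)
decomp L = decompF (length L) L

-- the pairs (b_{π,i,j} , c_{π,i,j})_j, with σ = s^{i-1}(π)
colData : List ℕ → ℕ → List (List ℕ × ℕ)
colData π i = decomp (proj₁ (breakAt 0 (iter (i ∸ 1) s π)))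

C : List ℕ → ℕ → List ℕ
C π i = map proj₂ (colData π i)

-- 1-based index of x in a list
indexOf : ℕ → List ℕ → Maybe ℕ
indexOf x [] = nothing
indexOf x (y ∷ ys) with x ≡ᵇ y
... | true = just 1
... | false with indexOf x ys
...   | just j = just (suc j)
...   | nothing = nothing

searchCols : List ℕ → ℕ → List ℕ → ℕ × ℕ
searchCols π x [] = 0 , 0
searchCols π x (i ∷ is) with indexOf x (C π i)
... | just j = i , j
... | nothing = searchCols π x is

range1 : ℕ → List ℕ
range1 m = map suc (upTo m)

-- (col_π(x), colpos_π(x)): the pair (i,j) with x = c_{π,i,j}, 1 ≤ i ≤ sc(π)
position : List ℕ → ℕ → ℕ × ℕ
position π x = searchCols π x (range1 (sc π))

col : List ℕ → ℕ → ℕ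
col π x = proj₁ (position π x)

colpos : List ℕ → ℕ → ℕ
colpos π x = proj₂ (position π x)

leftofSearch : ℕ → List (List ℕ × ℕ) → ℕ
leftofSearch x [] = 0
leftofSearch x ((b , c) ∷ bs) =
  if isNonEmpty b ∧ (maxL b ≡ᵇ x) then c else leftofSearch x bs

-- leftof_π(x) = c_{π,col(x)-1,j} where x = max(b_{π,col(x)-1,j})
leftof : List ℕ → ℕ → ℕ
leftof π x = leftofSearch x (colData π (col π x ∸ 1))

-- row, recursion on col (fuel = col(x), since col(leftof x) = col x - 1)
rowF : List ℕ → ℕ → ℕ → ℕ
rowF π zero x = colpos π x
rowF π (suc f) x = if col π x ≤ᵇ 1 then colpos π x else rowF π f (leftof π x)

row : List ℕ → ℕ → ℕ
row π x = rowF π (col π x) x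

α : ℕ → List ℕ → List ℕ
α n π = map (λ j → length (filterᵇ (λ x → row π x ≡ᵇ j) (range1 n)))
            (range1 (length (C π 1)))

Tab : List ℕ → ℕ → ℕ × ℕ
Tab π x = col π x , row π x

InS' : ℕ → List ℕ → Set
InS' n π = (π ↭ upTo (suc n)) × ∃ λ ρ → π ≡ ρ ++ [ 0 ]

-- entry at 0-based position k (default 0)
at : List ℕ → ℕ → ℕ
at [] k = 0
at (a ∷ as) zero = a
at (a ∷ as) (suc k) = at as k

InD : List ℕ → ℕ × ℕ → Set
InD a (i , j) = (1 ≤ i) × (1 ≤ j) × (j ≤ length a) × (i ≤ at a (j ∸ 1))

{-# OPTIONS --safe #-}

-- Write s^k(π) = L ++ 0 ∷ R and decompose L = b₁ c₁ ⋯ b_m c_m by successive maxima.  Since 0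
-- is smaller than every other entry, s^{k+1}(π) starts with s(b₁) ⋯ s(b_m) followed by 0: the
-- column C_{k+1} = (c₁, …, c_m) is removed from the left of 0 and nothing else is.  Hence the
-- columns partition [n].  An entry x of C_{k+2} is a right-to-left maximum of s(b₁) ⋯ s(b_m),
-- and s(b) ends with max b, so x = max b_j for a unique j; thus leftof x = c_j, leftof preserves
-- rows and is injective on each column, which makes T_π injective.  Following leftof from x
-- visits every column to the left of x in row(x), so row j occupies exactly columns 1, …, α_j.

module Submission where

open import Defs
open import Data.Nat
  using (ℕ; zero; suc; _+_; _∸_; _≤_; _<_; _≤′_; ≤′-refl; ≤′-step; z≤n; s≤s; z<s; s≤s⁻¹; _<ᵇ_; _≤ᵇ_; _≡ᵇ_)
open import Data.Nat.Properties
open import Data.Bool using (Bool; true; false; T; if_then_else_)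
open import Data.Bool.Properties using (∧-zeroʳ)
open import Data.List using (List; []; _∷_; _++_; [_]; length; map; concat; upTo; applyUpTo; filterᵇ)
open import Data.List.Properties
  using (length-++; length-map; length-upTo; ++-assoc; ++-identityʳ; ∷-injectiveʳ)
open import Data.List.Relation.Unary.All as All using (All; []; _∷_)
import Data.List.Relation.Unary.All.Properties as All
open import Data.List.Relation.Unary.Any using (Any; here; there)
open import Data.List.Relation.Unary.Unique.Propositional using (Unique; []; _∷_)
import Data.List.Relation.Unary.Unique.Propositional.Properties as Uniqueₚ
open Uniqueₚ using (Unique[x∷xs]⇒x∉xs)
open import Data.List.Membership.Propositional using (_∈_; _∉_)
open import Data.List.Membership.Propositional.Properties
  using (∈-++⁺ˡ; ∈-++⁺ʳ; ∈-++⁻; ∈-∃++; ∈-length; ∈-filter⁺; ∈-filter⁻; ∈-map⁺; ∈-map⁻; ∈-upTo⁺; ∈-upTo⁻)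
open import Data.List.Relation.Binary.Permutation.Propositional
  using (_↭_; ↭⇒↭ₛ; ↭-refl; ↭-trans; ↭-sym; prep; module PermutationReasoning)
open import Data.List.Relation.Binary.Permutation.Propositional.Properties
  using (++⁺; ++⁺ˡ; shift; shifts; ∈-resp-↭; ↭-length)
import Data.List.Relation.Binary.Permutation.Setoid.Properties as Setoid↭
open import Data.Maybe using (just; nothing)
open import Data.Maybe.Properties using (just-injective)
open import Data.Product using (_×_; _,_; proj₁; proj₂; ∃; ∃₂)
open import Data.Sum using (_⊎_; inj₁; inj₂)
open import Function using (_∘_; id)
open import Relation.Nullary using (yes; no; contradiction)
open import Relation.Nullary.Decidable using (T?)
open import Relation.Nullary.Reflects using (Reflects; ofʸ; ofⁿ; fromEquivalence)
open import Relation.Binary.Definitions using (tri<; tri≈; tri>)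
open import Relation.Binary.PropositionalEquality
  using (_≡_; _≢_; setoid; refl; sym; trans; cong; cong₂; subst; subst₂; module ≡-Reasoning)

≡ᵇ-reflects-≡ : ∀ m n → Reflects (m ≡ n) (m ≡ᵇ n)
≡ᵇ-reflects-≡ m n = fromEquivalence (≡ᵇ⇒≡ m n) (≡⇒≡ᵇ m n)

-- Duplicate-free lists, maxima and positions

Unique-↭ : ∀ {xs ys : List ℕ} → xs ↭ ys → Unique xs → Unique ys
Unique-↭ p = Setoid↭.Unique-resp-↭ (setoid ℕ) (↭⇒↭ₛ p)

Unique-++⁻ˡ : ∀ (A : List ℕ) {B} → Unique (A ++ B) → Unique A
Unique-++⁻ˡ []      _        = []
Unique-++⁻ˡ (a ∷ A) (a∉ ∷ u) = All.++⁻ˡ A a∉ ∷ Unique-++⁻ˡ A u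

Unique-++⁻ʳ : ∀ (A : List ℕ) {B} → Unique (A ++ B) → Unique B
Unique-++⁻ʳ []      u       = u
Unique-++⁻ʳ (a ∷ A) (_ ∷ u) = Unique-++⁻ʳ A u

Unique-++⇒disjoint : ∀ (A : List ℕ) {B x} → Unique (A ++ B) → x ∈ A → x ∉ B
Unique-++⇒disjoint (a ∷ A) (a∉ ∷ u) (here refl) x∈B = All.lookup (All.++⁻ʳ A a∉) x∈B refl
Unique-++⇒disjoint (a ∷ A) (_ ∷ u)  (there x∈A) x∈B = Unique-++⇒disjoint A u x∈A x∈B

Unique-++-∷⇒∉ : ∀ (A : List ℕ) {m B} → Unique (A ++ m ∷ B) → m ∉ A × m ∉ B
Unique-++-∷⇒∉ A u =
  (λ m∈A → Unique-++⇒disjoint A u m∈A (here refl)) , Unique[x∷xs]⇒x∉xs (Unique-++⁻ʳ A u)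

Unique-map⁺-on : ∀ (f : ℕ → ℕ) {xs} → (∀ {x y} → x ∈ xs → y ∈ xs → f x ≡ f y → x ≡ y) →
  Unique xs → Unique (map f xs)
Unique-map⁺-on f {[]}     _   []       = []
Unique-map⁺-on f {x ∷ xs} inj (x∉ ∷ u) =
  All.map⁺ (All.tabulate λ y∈ fx≡fy → All.lookup x∉ y∈ (inj (here refl) (there y∈) fx≡fy))
  ∷ Unique-map⁺-on f (λ x∈ y∈ → inj (there x∈) (there y∈)) u

Unique-map-proj₂⇒functional : ∀ {ds : List (List ℕ × ℕ)} {b b′ c} → Unique (map proj₂ ds) →
  (b , c) ∈ ds → (b′ , c) ∈ ds → b ≡ b′
Unique-map-proj₂⇒functional _        (here refl) (here refl) = refl
Unique-map-proj₂⇒functional (c∉ ∷ _) (here refl) (there m)   = contradiction refl (All.lookup c∉ (∈-map⁺ _ m))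
Unique-map-proj₂⇒functional (c∉ ∷ _) (there m)   (here refl) = contradiction refl (All.lookup c∉ (∈-map⁺ _ m))
Unique-map-proj₂⇒functional (_ ∷ u)  (there m)   (there m′)  = Unique-map-proj₂⇒functional u m m′

Unique-⊆⇒length-≤ : ∀ (xs ys : List ℕ) → Unique xs → (∀ {z} → z ∈ xs → z ∈ ys) → length xs ≤ length ys
Unique-⊆⇒length-≤ []       ys _          _   = z≤n
Unique-⊆⇒length-≤ (x ∷ xs) ys (x∉xs ∷ u) xs⊆ with ∈-∃++ (xs⊆ (here refl))
... | ys₁ , ys₂ , refl = begin
  suc (length xs)               ≤⟨ s≤s (Unique-⊆⇒length-≤ xs (ys₁ ++ ys₂) u xs⊆ys₁ys₂) ⟩
  suc (length (ys₁ ++ ys₂))     ≡⟨ ↭-length (shift x ys₁ ys₂) ⟨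
  length (ys₁ ++ x ∷ ys₂)       ∎
  where
  open ≤-Reasoning
  xs⊆ys₁ys₂ : ∀ {z} → z ∈ xs → z ∈ ys₁ ++ ys₂
  xs⊆ys₁ys₂ {z} z∈xs with ∈-++⁻ ys₁ (xs⊆ (there z∈xs))
  ... | inj₁ z∈ys₁           = ∈-++⁺ˡ z∈ys₁
  ... | inj₂ (here refl)     = contradiction refl (All.lookup x∉xs z∈xs)
  ... | inj₂ (there z∈ys₂)   = ∈-++⁺ʳ ys₁ z∈ys₂

length-suffix< : ∀ (b : List ℕ) m a → length a < length (b ++ m ∷ a)
length-suffix< []      m a = ≤-refl
length-suffix< (_ ∷ b) m a = m≤n⇒m≤1+n (length-suffix< b m a)

maxL-≥ : ∀ xs → All (_≤ maxL xs) xs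
maxL-≥ []       = []
maxL-≥ (y ∷ ys) = m≤m⊔n y (maxL ys) ∷ All.map (λ z≤ → ≤-trans z≤ (m≤n⊔m y (maxL ys))) (maxL-≥ ys)

maxL-∈ : ∀ y ys → maxL (y ∷ ys) ∈ y ∷ ys
maxL-∈ y []       = here (⊔-identityʳ y)
maxL-∈ y (z ∷ zs) with ⊔-sel y (maxL (z ∷ zs))
... | inj₁ M≡y = here M≡y
... | inj₂ M≡m = there (subst (_∈ z ∷ zs) (sym M≡m) (maxL-∈ z zs))

maxL-∈′ : ∀ xs → 1 ≤ length xs → maxL xs ∈ xs
maxL-∈′ (y ∷ ys) _ = maxL-∈ y ys

≤∧∉⇒< : ∀ {M} xs → All (_≤ M) xs → M ∉ xs → All (_< M) xs
≤∧∉⇒< xs ≤M M∉ = All.tabulate λ {x} x∈ →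
  ≤∧≢⇒< (All.lookup ≤M x∈) (λ x≡M → M∉ (subst (_∈ xs) x≡M x∈))

breakAt-∈ : ∀ {v} L → v ∈ L → L ≡ proj₁ (breakAt v L) ++ v ∷ proj₂ (breakAt v L)
breakAt-∈ {v} (x ∷ xs) v∈ with x ≡ᵇ v | ≡ᵇ-reflects-≡ x v | v∈
... | true  | ofʸ refl | _          = refl
... | false | ofⁿ x≢v  | here refl  = contradiction refl x≢v
... | false | _        | there v∈xs = cong (x ∷_) (breakAt-∈ xs v∈xs)

breakAt-++ : ∀ {v} P {Q} → v ∉ P → breakAt v (P ++ v ∷ Q) ≡ (P , Q)
breakAt-++ {v} [] v∉ with v ≡ᵇ v | ≡ᵇ-reflects-≡ v v
... | true  | _        = refl
... | false | ofⁿ v≢v  = contradiction refl v≢v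
breakAt-++ {v} (p ∷ P) v∉ with p ≡ᵇ v | ≡ᵇ-reflects-≡ p v
... | true  | ofʸ refl = contradiction (here refl) v∉
... | false | _        = cong (λ (b , a) → p ∷ b , a) (breakAt-++ P (λ v∈P → v∉ (there v∈P)))

breakAt-maxL : ∀ y ys → Unique (y ∷ ys) →
  let M = maxL (y ∷ ys) ; (b , a) = breakAt M (y ∷ ys) in
  y ∷ ys ≡ b ++ M ∷ a × All (_< M) b × All (_< M) a
breakAt-maxL y ys u = split , ≤∧∉⇒< b (All.++⁻ˡ b ≤M) M∉b , ≤∧∉⇒< a (All.tail (All.++⁻ʳ b ≤M)) M∉a
  where
  M : ℕ
  M = maxL (y ∷ ys)
  b a : List ℕ
  b = proj₁ (breakAt M (y ∷ ys))
  a = proj₂ (breakAt M (y ∷ ys))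
  split : y ∷ ys ≡ b ++ M ∷ a
  split = breakAt-∈ (y ∷ ys) (maxL-∈ y ys)
  ≤M : All (_≤ M) (b ++ M ∷ a)
  ≤M = subst (All (_≤ M)) split (maxL-≥ (y ∷ ys))
  M∉b : M ∉ b
  M∉b = proj₁ (Unique-++-∷⇒∉ b (subst Unique split u))
  M∉a : M ∉ a
  M∉a = proj₂ (Unique-++-∷⇒∉ b (subst Unique split u))

indexOf-∈ : ∀ {x} l → x ∈ l → ∃ λ j → indexOf x l ≡ just j × 1 ≤ j × j ≤ length l
indexOf-∈ {x} (y ∷ ys) x∈ with x ≡ᵇ y | ≡ᵇ-reflects-≡ x y | x∈
... | true  | _       | _          = 1 , refl , ≤-refl , s≤s z≤n
... | false | ofⁿ x≢y | here x≡y   = contradiction x≡y x≢y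
... | false | _       | there x∈ys with indexOf x ys | indexOf-∈ ys x∈ys
...   | just j  | _ , refl , _ , j≤ = suc j , refl , s≤s z≤n , s≤s j≤
...   | nothing | _ , () , _

indexOf-∉ : ∀ {x} l → x ∉ l → indexOf x l ≡ nothing
indexOf-∉ []       _  = refl
indexOf-∉ {x} (y ∷ ys) x∉ with x ≡ᵇ y | ≡ᵇ-reflects-≡ x y
... | true  | ofʸ x≡y = contradiction (here x≡y) x∉
... | false | _ rewrite indexOf-∉ ys (λ x∈ys → x∉ (there x∈ys)) = refl

indexOf-at : ∀ {x} l {j} → indexOf x l ≡ just j → ∃ λ i → j ≡ suc i × at l i ≡ x
indexOf-at {x} (y ∷ ys) eq with x ≡ᵇ y | ≡ᵇ-reflects-≡ x y
... | true  | ofʸ x≡y = 0 , sym (just-injective eq) , sym x≡y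
... | false | _ with indexOf x ys in eq′
...   | just j with indexOf-at ys eq′
...     | i , refl , at≡x = suc i , sym (just-injective eq) , at≡x

indexOf-injective : ∀ {x y} l {j} → indexOf x l ≡ just j → indexOf y l ≡ just j → x ≡ y
indexOf-injective l ix iy with indexOf-at l ix | indexOf-at l iy
... | i , refl , at≡x | .i , refl , at≡y = trans (sym at≡x) at≡y

∈-range1⁺ : ∀ {i m} → 1 ≤ i → i ≤ m → i ∈ range1 m
∈-range1⁺ {suc i} _ i<m = ∈-map⁺ suc (∈-upTo⁺ i<m)

∈-range1⁻ : ∀ {i m} → i ∈ range1 m → ∃ λ k → i ≡ suc k × k < m
∈-range1⁻ i∈ = let k , k∈ , i≡ = ∈-map⁻ suc i∈ in k , i≡ , ∈-upTo⁻ k∈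

Unique-range1 : ∀ m → Unique (range1 m)
Unique-range1 m = Uniqueₚ.map⁺ suc-injective (Uniqueₚ.upTo⁺ m)

length-range1 : ∀ m → length (range1 m) ≡ m
length-range1 m = trans (length-map suc (upTo m)) (length-upTo m)

length≤maxL : ∀ xs → Unique xs → All (1 ≤_) xs → length xs ≤ maxL xs
length≤maxL xs u xs≥1 = subst (length xs ≤_) (length-range1 (maxL xs))
  (Unique-⊆⇒length-≤ xs (range1 (maxL xs)) u
    λ z∈ → ∈-range1⁺ (All.lookup xs≥1 z∈) (All.lookup (maxL-≥ xs) z∈))

at-map : ∀ (f : ℕ → ℕ) xs {i} → i < length xs → at (map f xs) i ≡ f (at xs i)
at-map f (x ∷ xs) {zero}  _         = refl
at-map f (x ∷ xs) {suc i} (s≤s i<) = at-map f xs i<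

at-applyUpTo : ∀ (g : ℕ → ℕ) m {i} → i < m → at (applyUpTo g m) i ≡ g i
at-applyUpTo g (suc m) {zero}  _         = refl
at-applyUpTo g (suc m) {suc i} (s≤s i<m) = at-applyUpTo (g ∘ suc) m i<m

at-map-range1 : ∀ (f : ℕ → ℕ) m {i} → i < m → at (map f (range1 m)) i ≡ f (suc i)
at-map-range1 f m {i} i<m = begin
  at (map f (range1 m)) i       ≡⟨ at-map f (range1 m) (subst (i <_) (sym (length-range1 m)) i<m) ⟩
  f (at (map suc (upTo m)) i)   ≡⟨ cong f (at-map suc (upTo m) (subst (i <_) (sym (length-upTo m)) i<m)) ⟩
  f (suc (at (upTo m) i))       ≡⟨ cong (f ∘ suc) (at-applyUpTo id m i<m) ⟩
  f (suc i)                     ∎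
  where open ≡-Reasoning

-- The stack-sorting map

popWhile-++ : ∀ x st → proj₁ (popWhile x st) ++ proj₂ (popWhile x st) ≡ st
popWhile-++ x [] = refl
popWhile-++ x (t ∷ st) with x <ᵇ t
... | true  = refl
... | false = cong (t ∷_) (popWhile-++ x st)

popWhile-stops-at-larger : ∀ {x} A {B} → All (x <_) B →
  popWhile x (A ++ B) ≡ (proj₁ (popWhile x A) , proj₂ (popWhile x A) ++ B)
popWhile-stops-at-larger [] {[]} _ = refl
popWhile-stops-at-larger {x} [] {t ∷ B} (x<t ∷ _) with x <ᵇ t | <ᵇ-reflects-< x t
... | true  | _       = refl
... | false | ofⁿ x≮t = contradiction x<t x≮t
popWhile-stops-at-larger {x} (t ∷ A) hB with x <ᵇ t
... | true  = refl
... | false rewrite popWhile-stops-at-larger A hB = refl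

popWhile-pops-smaller : ∀ {x} A → All (_< x) A → popWhile x A ≡ (A , [])
popWhile-pops-smaller [] _ = refl
popWhile-pops-smaller {x} (t ∷ A) (t<x ∷ hA) with x <ᵇ t | <ᵇ-reflects-< x t
... | true  | ofʸ x<t = contradiction t<x (<-asym x<t)
... | false | _ rewrite popWhile-pops-smaller A hA = refl

stackRun : List ℕ → List ℕ → List ℕ × List ℕ
stackRun [] st = [] , st
stackRun (x ∷ xs) st =
  let (p , r)   = popWhile x st
      (o , st′) = stackRun xs (x ∷ r)
  in p ++ o , st′

stackOut stackRest : List ℕ → List ℕ → List ℕ
stackOut xs st = proj₁ (stackRun xs st)
stackRest xs st = proj₂ (stackRun xs st)

Below : List ℕ → List ℕ → Set
Below xs st = All (λ x → All (x <_) st) xs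

Below-[] : ∀ xs → Below xs []
Below-[] xs = All.tabulate (λ _ → [])

stackGo-++-Below : ∀ xs ys st₀ {st} → Below xs st →
  stackGo (xs ++ ys) (st₀ ++ st) ≡ stackOut xs st₀ ++ stackGo ys (stackRest xs st₀ ++ st)
stackGo-++-Below []       ys st₀ _ = refl
stackGo-++-Below (x ∷ xs) ys st₀ (x<st ∷ hxs)
  rewrite popWhile-stops-at-larger st₀ x<st
        | stackGo-++-Below xs ys (x ∷ proj₂ (popWhile x st₀)) hxs
  = sym (++-assoc (proj₁ (popWhile x st₀)) _ _)

s-stackRun : ∀ xs → s xs ≡ stackOut xs [] ++ stackRest xs []
s-stackRun xs = begin
  stackGo xs []                                 ≡⟨ cong (λ ys → stackGo ys []) (++-identityʳ xs) ⟨
  stackGo (xs ++ []) []                         ≡⟨ stackGo-++-Below xs [] [] (Below-[] xs) ⟩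
  stackOut xs [] ++ (stackRest xs [] ++ [])     ≡⟨ cong (stackOut xs [] ++_) (++-identityʳ _) ⟩
  stackOut xs [] ++ stackRest xs []             ∎
  where open ≡-Reasoning

stackRest-All : ∀ {P : ℕ → Set} xs {st} → All P xs → All P st → All P (stackRest xs st)
stackRest-All [] _ hst = hst
stackRest-All {P} (x ∷ xs) {st} (px ∷ hxs) hst = stackRest-All xs hxs (px ∷ rest)
  where
  rest : All P (proj₂ (popWhile x st))
  rest = All.++⁻ʳ (proj₁ (popWhile x st)) (subst (All P) (sym (popWhile-++ x st)) hst)

stackGo-∷-pops-smaller : ∀ {m} Y A → All (_< m) A → ∀ {st} → All (m <_) st →
  stackGo (m ∷ Y) (A ++ st) ≡ A ++ stackGo Y (m ∷ st)
stackGo-∷-pops-smaller Y A A<m m<st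
  rewrite popWhile-stops-at-larger A m<st | popWhile-pops-smaller A A<m = refl

s-++-max : ∀ A m B → All (_< m) A → All (_< m) B → s (A ++ m ∷ B) ≡ s A ++ s B ++ [ m ]
s-++-max A m B A<m B<m = begin
  stackGo (A ++ m ∷ B) []                                    ≡⟨ stackGo-++-Below A (m ∷ B) [] (Below-[] A) ⟩
  stackOut A [] ++ stackGo (m ∷ B) (stackRest A [] ++ [])    ≡⟨ cong (stackOut A [] ++_) read-m ⟩
  stackOut A [] ++ stackRest A [] ++ stackGo B [ m ]         ≡⟨ ++-assoc (stackOut A []) _ _ ⟨
  (stackOut A [] ++ stackRest A []) ++ stackGo B [ m ]       ≡⟨ cong₂ _++_ (s-stackRun A) read-B ⟨
  s A ++ s B ++ [ m ]                                        ∎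
  where
  open ≡-Reasoning
  read-m : stackGo (m ∷ B) (stackRest A [] ++ []) ≡ stackRest A [] ++ stackGo B [ m ]
  read-m = stackGo-∷-pops-smaller B (stackRest A []) (stackRest-All A A<m []) []
  read-B : s B ++ [ m ] ≡ stackGo B [ m ]
  read-B = begin
    s B ++ [ m ]                                      ≡⟨ cong (_++ [ m ]) (s-stackRun B) ⟩
    (stackOut B [] ++ stackRest B []) ++ [ m ]        ≡⟨ ++-assoc (stackOut B []) _ _ ⟩
    stackOut B [] ++ stackRest B [] ++ [ m ]          ≡⟨ stackGo-++-Below B [] [] (All.map (_∷ []) B<m) ⟨
    stackGo (B ++ []) [ m ]                           ≡⟨ cong (λ ys → stackGo ys [ m ]) (++-identityʳ B) ⟩
    stackGo B [ m ]                                   ∎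

stackGo-↭ : ∀ xs st → stackGo xs st ↭ xs ++ st
stackGo-↭ [] st = ↭-refl
stackGo-↭ (x ∷ xs) st =
  let (p , r) = popWhile x st in
  ↭-trans (++⁺ˡ p (stackGo-↭ xs (x ∷ r)))
  (↭-trans (shifts p xs)
  (↭-trans (++⁺ˡ xs (shift x p r))
  (↭-trans (shift x xs (p ++ r))
   (prep x (++⁺ˡ xs (subst (p ++ r ↭_) (popWhile-++ x st) ↭-refl))))))

s-↭ : ∀ xs → s xs ↭ xs
s-↭ xs = subst (s xs ↭_) (++-identityʳ xs) (stackGo-↭ xs [])

s-∷ʳ-maxL : ∀ y ys → Unique (y ∷ ys) → ∃ λ S → s (y ∷ ys) ≡ S ++ [ maxL (y ∷ ys) ]
s-∷ʳ-maxL y ys u =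
  let split , b<M , a<M = breakAt-maxL y ys u
      b = proj₁ (breakAt (maxL (y ∷ ys)) (y ∷ ys))
      a = proj₂ (breakAt (maxL (y ∷ ys)) (y ∷ ys))
  in s b ++ s a , trans (cong s split) (trans (s-++-max b _ a b<M a<M) (sym (++-assoc (s b) (s a) _)))

-- Right-to-left maxima

RLMax : ℕ → List ℕ → Set
RLMax x L = ∃₂ λ P Q → L ≡ P ++ x ∷ Q × All (_< x) Q

RLMax⇒∈ : ∀ {x L} → RLMax x L → x ∈ L
RLMax⇒∈ (P , Q , refl , _) = ∈-++⁺ʳ P (here refl)

RLMax-++⁻ : ∀ A {B x} → RLMax x (A ++ B) → RLMax x A × All (_< x) B ⊎ RLMax x B
RLMax-++⁻ []      r = inj₂ r
RLMax-++⁻ (a ∷ A) ([] , Q , refl , Q<x) = inj₁ (([] , A , refl , All.++⁻ˡ A Q<x) , All.++⁻ʳ A Q<x)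
RLMax-++⁻ (a ∷ A) (p ∷ P , Q , e , Q<x) with RLMax-++⁻ A (P , Q , ∷-injectiveʳ e , Q<x)
... | inj₁ ((P′ , Q′ , e′ , Q′<x) , B<x) = inj₁ ((a ∷ P′ , Q′ , cong (a ∷_) e′ , Q′<x) , B<x)
... | inj₂ r = inj₂ r

RLMax-∷ʳ⁻ : ∀ S {M x} → RLMax x (S ++ [ M ]) → x ≡ M ⊎ M < x
RLMax-∷ʳ⁻ S r with RLMax-++⁻ S r
... | inj₁ (_ , M<x ∷ [])            = inj₂ M<x
... | inj₂ ([] , [] , refl , _)      = inj₁ refl
... | inj₂ ([] , _ ∷ _ , () , _)
... | inj₂ (_ ∷ [] , _ , () , _)
... | inj₂ (_ ∷ _ ∷ _ , _ , () , _)

IsMaxOf : ℕ → List ℕ → Set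
IsMaxOf x b = T (isNonEmpty b) × maxL b ≡ x

-- s b ends with max b, so any other right-to-left maximum of s b would exceed max b.
RLMax-s⇒IsMaxOf : ∀ {x} b → Unique b → RLMax x (s b) → IsMaxOf x b
RLMax-s⇒IsMaxOf []       _ ([] , _ , () , _)
RLMax-s⇒IsMaxOf []       _ (_ ∷ _ , _ , () , _)
RLMax-s⇒IsMaxOf {x} (y ∷ ys) u r with s-∷ʳ-maxL y ys u
... | S , s≡ with RLMax-∷ʳ⁻ S (subst (RLMax _) s≡ r)
...   | inj₁ x≡M = _ , sym x≡M
...   | inj₂ M<x = contradiction (All.lookup (maxL-≥ (y ∷ ys)) x∈) (<⇒≱ M<x)
  where
  x∈ : x ∈ y ∷ ys
  x∈ = ∈-resp-↭ (s-↭ (y ∷ ys)) (RLMax⇒∈ r)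

-- Decomposition into blocks and one pass of s

-- The paper's L = b₁ c₁ b₂ c₂ ⋯ b_k c_k, where c_j = max (b_j c_j ⋯ b_k c_k).
data Decomposition : List ℕ → List (List ℕ × ℕ) → Set where
  []    : Decomposition [] []
  block : ∀ {b m a ds} → All (_< m) b → All (_< m) a → Decomposition a ds →
          Decomposition (b ++ m ∷ a) ((b , m) ∷ ds)

sortedBlocks : List (List ℕ × ℕ) → List ℕ
sortedBlocks ds = concat (map (s ∘ proj₁) ds)

decompF-Decomposition : ∀ f L → length L ≤ f → Unique L → Decomposition L (decompF f L)
decompF-Decomposition zero    []       _ _ = []
decompF-Decomposition (suc f) []       _ _ = []
decompF-Decomposition (suc f) (y ∷ ys) (s≤s |L|≤f) u =
  subst (λ L → Decomposition L ((b , M) ∷ decompF f a)) (sym split)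
    (block b<M a<M (decompF-Decomposition f a |a|≤f (Unique-++⁻ʳ (b ++ [ M ]) u′)))
  where
  M : ℕ
  M = maxL (y ∷ ys)
  b a : List ℕ
  b = proj₁ (breakAt M (y ∷ ys))
  a = proj₂ (breakAt M (y ∷ ys))
  split : y ∷ ys ≡ b ++ M ∷ a
  split = proj₁ (breakAt-maxL y ys u)
  b<M : All (_< M) b
  b<M = proj₁ (proj₂ (breakAt-maxL y ys u))
  a<M : All (_< M) a
  a<M = proj₂ (proj₂ (breakAt-maxL y ys u))
  u′ : Unique ((b ++ [ M ]) ++ a)
  u′ = subst Unique (trans split (sym (++-assoc b [ M ] a))) u
  |a|≤f : length a ≤ f
  |a|≤f = s≤s⁻¹ (<-≤-trans (subst (λ L → length a < length L) (sym split) (length-suffix< b M a))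
                           (s≤s |L|≤f))

decomp-Decomposition : ∀ {L} → Unique L → Decomposition L (decomp L)
decomp-Decomposition {L} = decompF-Decomposition (length L) L ≤-refl

Decomposition-nonempty : ∀ {L ds x} → Decomposition L ds → x ∈ L → 1 ≤ length (map proj₂ ds)
Decomposition-nonempty (block _ _ _) _ = s≤s z≤n

Decomposition-↭ : ∀ {L ds} → Decomposition L ds → L ↭ sortedBlocks ds ++ map proj₂ ds
Decomposition-↭ [] = ↭-refl
Decomposition-↭ (block {b} {m} {a} {ds} _ _ d) = begin
  b ++ m ∷ a                                    ↭⟨ ++⁺ (↭-sym (s-↭ b)) (prep m (Decomposition-↭ d)) ⟩
  s b ++ m ∷ sortedBlocks ds ++ map proj₂ ds    ↭⟨ ++⁺ˡ (s b) (shift m (sortedBlocks ds) _) ⟨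
  s b ++ sortedBlocks ds ++ m ∷ map proj₂ ds    ≡⟨ ++-assoc (s b) (sortedBlocks ds) _ ⟨
  (s b ++ sortedBlocks ds) ++ m ∷ map proj₂ ds  ∎
  where open PermutationReasoning

Decomposition-RLMax : ∀ {L ds x} → Decomposition L ds → x ∈ map proj₂ ds → RLMax x L
Decomposition-RLMax (block {b} {m} {a} _ a<m _) (here refl) = b , a , refl , a<m
Decomposition-RLMax (block {b} {m} {a} _ _ d) (there x∈) =
  let P , Q , L≡ , Q<x = Decomposition-RLMax d x∈
  in b ++ m ∷ P , Q , trans (cong (λ a → b ++ m ∷ a) L≡) (sym (++-assoc b (m ∷ P) _)) , Q<x

Decomposition-Unique-blocks : ∀ {L ds} → Decomposition L ds → Unique L → All (Unique ∘ proj₁) ds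
Decomposition-Unique-blocks []                 _ = []
Decomposition-Unique-blocks (block {b} _ _ d) u =
  Unique-++⁻ˡ b u ∷
  Decomposition-Unique-blocks d (Unique-++⁻ʳ (b ++ [ _ ]) (subst Unique (sym (++-assoc b _ _)) u))

sortedBlocks-RLMax : ∀ {x} ds → All (Unique ∘ proj₁) ds → RLMax x (sortedBlocks ds) →
  Any (IsMaxOf x ∘ proj₁) ds
sortedBlocks-RLMax []              _          ([] , _ , () , _)
sortedBlocks-RLMax []              _          (_ ∷ _ , _ , () , _)
sortedBlocks-RLMax ((b , _) ∷ ds) (ub ∷ ubs) r with RLMax-++⁻ (s b) r
... | inj₁ (r′ , _) = here (RLMax-s⇒IsMaxOf b ub r′)
... | inj₂ r′       = there (sortedBlocks-RLMax ds ubs r′)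

leftofSearch-∈ : ∀ {x} ds → Any (IsMaxOf x ∘ proj₁) ds →
  ∃ λ b → (b , leftofSearch x ds) ∈ ds × IsMaxOf x b
leftofSearch-∈ (([] , c) ∷ ds) (there m) =
  let b , b∈ , b-max = leftofSearch-∈ ds m in b , there b∈ , b-max
leftofSearch-∈ {x} ((y ∷ ys , c) ∷ ds) m with maxL (y ∷ ys) ≡ᵇ x | ≡ᵇ-reflects-≡ (maxL (y ∷ ys)) x | m
... | true  | ofʸ M≡x | _               = y ∷ ys , here refl , _ , M≡x
... | false | ofⁿ M≢x | here (_ , M≡x) = contradiction M≡x M≢x
... | false | _       | there m′        =
  let b , b∈ , b-max = leftofSearch-∈ ds m′ in b , there b∈ , b-max

stackGo-0∷ : ∀ R st → ∃ λ X → stackGo R (0 ∷ st) ≡ 0 ∷ X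
stackGo-0∷ []      st = st , refl
stackGo-0∷ (_ ∷ _) st = _ , refl

-- Reading c_j flushes what is left of b_j, and c_j then stays below everything read before 0.
stackGo-Decomposition : ∀ {L ds st} → Decomposition L ds →
  All (0 <_) L → Below L st → All (0 <_) st →
  ∀ R → ∃ λ X → stackGo (L ++ 0 ∷ R) st ≡ sortedBlocks ds ++ 0 ∷ X
stackGo-Decomposition {st = st} [] _ _ st>0 R
  rewrite popWhile-stops-at-larger [] st>0 = stackGo-0∷ R st
stackGo-Decomposition {st = st} (block {b} {m} {a} {ds} b<m a<m d) L>0 L<st st>0 R =
  let X , eq = stackGo-Decomposition d (All.tail a>0) a<m∷st (m>0 ∷ st>0) R in
  X , (begin
  stackGo ((b ++ m ∷ a) ++ 0 ∷ R) st
    ≡⟨ cong (λ L → stackGo L st) (++-assoc b (m ∷ a) (0 ∷ R)) ⟩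
  stackGo (b ++ m ∷ a ++ 0 ∷ R) ([] ++ st)
    ≡⟨ stackGo-++-Below b (m ∷ a ++ 0 ∷ R) [] (All.++⁻ˡ b L<st) ⟩
  stackOut b [] ++ stackGo (m ∷ a ++ 0 ∷ R) (stackRest b [] ++ st)
    ≡⟨ cong (stackOut b [] ++_) (stackGo-∷-pops-smaller (a ++ 0 ∷ R) (stackRest b []) b-rest<m m<st) ⟩
  stackOut b [] ++ stackRest b [] ++ stackGo (a ++ 0 ∷ R) (m ∷ st)
    ≡⟨ ++-assoc (stackOut b []) _ _ ⟨
  (stackOut b [] ++ stackRest b []) ++ stackGo (a ++ 0 ∷ R) (m ∷ st)
    ≡⟨ cong₂ _++_ (sym (s-stackRun b)) eq ⟩
  s b ++ sortedBlocks ds ++ 0 ∷ X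
    ≡⟨ ++-assoc (s b) (sortedBlocks ds) (0 ∷ X) ⟨
  (s b ++ sortedBlocks ds) ++ 0 ∷ X
    ∎)
  where
  open ≡-Reasoning
  b-rest<m : All (_< m) (stackRest b [])
  b-rest<m = stackRest-All b b<m []
  a>0 : All (0 <_) (m ∷ a)
  a>0 = All.++⁻ʳ b L>0
  m>0 : 0 < m
  m>0 = All.head a>0
  m<st : All (m <_) st
  m<st = All.head (All.++⁻ʳ b L<st)
  a<m∷st : Below a (m ∷ st)
  a<m∷st = All.zipWith (λ (x<m , x<st) → x<m ∷ x<st) (a<m , All.tail (All.++⁻ʳ b L<st))

s-++-0∷ : ∀ L R → Unique (L ++ 0 ∷ R) → ∃ λ X → s (L ++ 0 ∷ R) ≡ sortedBlocks (decomp L) ++ 0 ∷ X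
s-++-0∷ L R u = stackGo-Decomposition (decomp-Decomposition (Unique-++⁻ˡ L u)) L>0 (Below-[] L) [] R
  where
  L>0 : All (0 <_) L
  L>0 = All.tabulate λ {x} x∈L → n≢0⇒n>0 λ x≡0 → proj₁ (Unique-++-∷⇒∉ L u) (subst (_∈ L) x≡0 x∈L)

-- Number of passes and column search

iter-suc : ∀ {A : Set} j (f : A → A) a → iter j f (f a) ≡ iter (suc j) f a
iter-suc zero    f a = refl
iter-suc (suc j) f a = cong f (iter-suc j f a)

scFrom-≥ : ∀ f k σ → k ≤ scFrom f k σ
scFrom-≥ zero    k σ = ≤-refl
scFrom-≥ (suc f) k σ with isIncreasing σ
... | true  = ≤-refl
... | false = ≤-trans (n≤1+n k) (scFrom-≥ f (suc k) (s σ))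

NotSortedBefore : ℕ → List ℕ → Set
NotSortedBefore m σ = ∀ j → j < m → isIncreasing (iter j s σ) ≡ false

scFrom-≥-unsorted : ∀ f k σ m → m ≤ f → NotSortedBefore m σ → k + m ≤ scFrom f k σ
scFrom-≥-unsorted f k σ zero _ _ rewrite +-identityʳ k = scFrom-≥ f k σ
scFrom-≥-unsorted (suc f) k σ (suc m) (s≤s m≤f) unsorted rewrite unsorted 0 z<s | +-suc k m =
  scFrom-≥-unsorted f (suc k) (s σ) m m≤f λ j j<m →
    trans (cong isIncreasing (iter-suc j s σ)) (unsorted (suc j) (s≤s j<m))

sc-≥ : ∀ σ m → m ≤ length σ → NotSortedBefore m σ → m ≤ sc σ
sc-≥ σ m = scFrom-≥-unsorted (length σ) 0 σ m

isIncreasing-0∈ : ∀ y zs → 0 ∈ zs → isIncreasing (y ∷ zs) ≡ false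
isIncreasing-0∈ y (.0 ∷ zs) (here refl) = refl
isIncreasing-0∈ y (z ∷ zs)  (there 0∈) rewrite isIncreasing-0∈ z zs 0∈ = ∧-zeroʳ (y <ᵇ z)

isIncreasing-++-0∷ : ∀ {x} L R → x ∈ L → isIncreasing (L ++ 0 ∷ R) ≡ false
isIncreasing-++-0∷ (y ∷ ys) R _ = isIncreasing-0∈ y (ys ++ 0 ∷ R) (∈-++⁺ʳ ys (here refl))

searchCols-≡ : ∀ π x is {i j} → i ∈ is → indexOf x (C π i) ≡ just j →
  (∀ {i′} → i′ ∈ is → i′ ≢ i → indexOf x (C π i′) ≡ nothing) → searchCols π x is ≡ (i , j)
searchCols-≡ π x (i′ ∷ is) {i} i∈ x-in-i others with indexOf x (C π i′) in x-in-i′ | i′ ≟ i | i∈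
... | just j′ | yes refl | _          = cong (i ,_) (just-injective (trans (sym x-in-i′) x-in-i))
... | just j′ | no i′≢i  | _          = contradiction (trans (sym x-in-i′) (others (here refl) i′≢i)) λ ()
... | nothing | _        | here refl  = contradiction (trans (sym x-in-i) x-in-i′) λ ()
... | nothing | _        | there i∈is = searchCols-≡ π x is i∈is x-in-i (others ∘ there)

-- The tableau of π = ρ ++ [ 0 ]

module StackSortingTableau (n : ℕ) (ρ : List ℕ) (π↭ : ρ ++ [ 0 ] ↭ upTo (suc n)) where

  π : List ℕ
  π = ρ ++ [ 0 ]

  σ : ℕ → List ℕ
  σ k = iter k s π

  -- Indices are shifted by one: L k, D k and Cs k come from s^k(π), the paper's column k + 1,
  -- so that Cs k = C π (suc k) and D k = colData π (suc k).
  L : ℕ → List ℕ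
  L k = proj₁ (breakAt 0 (σ k))

  D : ℕ → List (List ℕ × ℕ)
  D k = decomp (L k)

  Cs : ℕ → List ℕ
  Cs k = map proj₂ (D k)

  _∈[n] : ℕ → Set
  x ∈[n] = 1 ≤ x × x ≤ n

  π-unique : Unique π
  π-unique = Unique-↭ (↭-sym π↭) (Uniqueₚ.upTo⁺ (suc n))

  σ-unique : ∀ k → Unique (σ k)
  σ-unique zero    = π-unique
  σ-unique (suc k) = Unique-↭ (↭-sym (s-↭ (σ k))) (σ-unique k)

  0∈σ : ∀ k → 0 ∈ σ k
  0∈σ zero    = ∈-++⁺ʳ ρ (here refl)
  0∈σ (suc k) = ∈-resp-↭ (↭-sym (s-↭ (σ k))) (0∈σ k)

  σ-split : ∀ k → σ k ≡ L k ++ 0 ∷ proj₂ (breakAt 0 (σ k))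
  σ-split k = breakAt-∈ (σ k) (0∈σ k)

  σ-split-unique : ∀ k → Unique (L k ++ 0 ∷ proj₂ (breakAt 0 (σ k)))
  σ-split-unique k = subst Unique (σ-split k) (σ-unique k)

  L-unique : ∀ k → Unique (L k)
  L-unique k = Unique-++⁻ˡ (L k) (σ-split-unique k)

  L-zero : L 0 ≡ ρ
  L-zero = cong proj₁ (breakAt-++ ρ (proj₁ (Unique-++-∷⇒∉ ρ π-unique)))

  L-suc : ∀ k → L (suc k) ≡ sortedBlocks (D k)
  L-suc k = trans (cong (proj₁ ∘ breakAt 0) σ-suc) (cong proj₁ (breakAt-++ (sortedBlocks (D k)) 0∉))
    where
    X : List ℕ
    X = proj₁ (s-++-0∷ (L k) _ (σ-split-unique k))
    σ-suc : σ (suc k) ≡ sortedBlocks (D k) ++ 0 ∷ X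
    σ-suc = trans (cong s (σ-split k)) (proj₂ (s-++-0∷ (L k) _ (σ-split-unique k)))
    0∉ : 0 ∉ sortedBlocks (D k)
    0∉ = proj₁ (Unique-++-∷⇒∉ (sortedBlocks (D k)) (subst Unique σ-suc (σ-unique (suc k))))

  D-Decomposition : ∀ k → Decomposition (L k) (D k)
  D-Decomposition k = decomp-Decomposition (L-unique k)

  L-↭ : ∀ k → L k ↭ L (suc k) ++ Cs k
  L-↭ k = subst (λ L′ → L k ↭ L′ ++ Cs k) (sym (L-suc k)) (Decomposition-↭ (D-Decomposition k))

  L-suc++Cs-unique : ∀ k → Unique (L (suc k) ++ Cs k)
  L-suc++Cs-unique k = Unique-↭ (L-↭ k) (L-unique k)

  Cs-unique : ∀ k → Unique (Cs k)
  Cs-unique k = Unique-++⁻ʳ (L (suc k)) (L-suc++Cs-unique k)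

  Cs⊆L : ∀ {x} k → x ∈ Cs k → x ∈ L k
  Cs⊆L k x∈ = ∈-resp-↭ (↭-sym (L-↭ k)) (∈-++⁺ʳ (L (suc k)) x∈)

  L-suc⊆L : ∀ {x} k → x ∈ L (suc k) → x ∈ L k
  L-suc⊆L k x∈ = ∈-resp-↭ (↭-sym (L-↭ k)) (∈-++⁺ˡ x∈)

  Cs∉L-suc : ∀ {x} k → x ∈ Cs k → x ∉ L (suc k)
  Cs∉L-suc k x∈C x∈L = Unique-++⇒disjoint (L (suc k)) (L-suc++Cs-unique k) x∈L x∈C

  L⊆Cs⊎L-suc : ∀ {x} k → x ∈ L k → x ∈ Cs k ⊎ x ∈ L (suc k)
  L⊆Cs⊎L-suc k x∈ with ∈-++⁻ (L (suc k)) (∈-resp-↭ (L-↭ k) x∈)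
  ... | inj₁ x∈L = inj₂ x∈L
  ... | inj₂ x∈C = inj₁ x∈C

  L-antitone : ∀ {x k j} → k ≤′ j → x ∈ L j → x ∈ L k
  L-antitone ≤′-refl                    x∈ = x∈
  L-antitone {j = suc j} (≤′-step k≤′j) x∈ = L-antitone k≤′j (L-suc⊆L j x∈)

  Cs-disjoint : ∀ {x} j j′ → x ∈ Cs j → x ∈ Cs j′ → j ≡ j′
  Cs-disjoint j j′ x∈ x∈′ with <-cmp j j′
  ... | tri≈ _ j≡j′ _ = j≡j′
  ... | tri< j<j′ _ _ = contradiction (L-antitone (≤⇒≤′ j<j′) (Cs⊆L j′ x∈′)) (Cs∉L-suc j x∈)
  ... | tri> _ _ j′<j = contradiction (L-antitone (≤⇒≤′ j′<j) (Cs⊆L j x∈)) (Cs∉L-suc j′ x∈′)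

  length-L-suc< : ∀ {x} k → x ∈ L k → length (L (suc k)) < length (L k)
  length-L-suc< k x∈ = begin-strict
    length (L (suc k))                        <⟨ m<m+n _ (Decomposition-nonempty (D-Decomposition k) x∈) ⟩
    length (L (suc k)) + length (Cs k)        ≡⟨ length-++ (L (suc k)) ⟨
    length (L (suc k) ++ Cs k)                ≡⟨ ↭-length (L-↭ k) ⟨
    length (L k)                              ∎
    where open ≤-Reasoning

  column-exists : ∀ {x} f k → length (L k) ≤ f → x ∈ L k → ∃ λ j → x ∈ Cs j
  column-exists zero    k |L|≤0 x∈ = contradiction |L|≤0 (<⇒≱ (∈-length x∈))
  column-exists (suc f) k |L|≤  x∈ with L⊆Cs⊎L-suc k x∈
  ... | inj₁ x∈C = k , x∈C
  ... | inj₂ x∈L = column-exists f (suc k) (s≤s⁻¹ (<-≤-trans (length-L-suc< k x∈) |L|≤)) x∈L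

  length-π : length π ≡ suc n
  length-π = trans (↭-length π↭) (length-upTo (suc n))

  length-ρ : length ρ ≡ n
  length-ρ = suc-injective (trans (+-comm 1 (length ρ)) (trans (sym (length-++ ρ)) length-π))

  length-L+k≤n : ∀ {x} k → x ∈ L k → length (L k) + k ≤ n
  length-L+k≤n zero    _  = ≤-reflexive (trans (+-identityʳ _) (trans (cong length L-zero) length-ρ))
  length-L+k≤n (suc k) x∈ = begin
    length (L (suc k)) + suc k     ≡⟨ +-suc (length (L (suc k))) k ⟩
    suc (length (L (suc k))) + k   ≤⟨ +-monoˡ-≤ k (length-L-suc< k (L-suc⊆L k x∈)) ⟩
    length (L k) + k               ≤⟨ length-L+k≤n k (L-suc⊆L k x∈) ⟩
    n                              ∎
    where open ≤-Reasoning

  L-nonempty⇒<sc : ∀ {x} k → x ∈ L k → k < sc π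
  L-nonempty⇒<sc {x} k x∈ = sc-≥ π (suc k) sk≤|π| unsorted
    where
    sk≤|π| : suc k ≤ length π
    sk≤|π| = subst (suc k ≤_) (sym length-π)
               (m≤n⇒m≤1+n (≤-trans (+-monoˡ-≤ k (∈-length x∈)) (length-L+k≤n k x∈)))
    unsorted : NotSortedBefore (suc k) π
    unsorted j j<sk = trans (cong isIncreasing (σ-split j))
                            (isIncreasing-++-0∷ (L j) _ (L-antitone (≤⇒≤′ (s≤s⁻¹ j<sk)) x∈))

  ∈[n]⇒∈L0 : ∀ {x} → x ∈[n] → x ∈ L 0
  ∈[n]⇒∈L0 {x} (1≤x , x≤n) with ∈-++⁻ ρ (∈-resp-↭ (↭-sym π↭) (∈-upTo⁺ (s≤s x≤n)))
  ... | inj₁ x∈ρ         = subst (x ∈_) (sym L-zero) x∈ρ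
  ... | inj₂ (here refl) = contradiction 1≤x λ ()

  ∈L⇒∈[n] : ∀ {x} k → x ∈ L k → x ∈[n]
  ∈L⇒∈[n] {x} k x∈ =
    n≢0⇒n>0 (λ x≡0 → 0∉ρ (subst (_∈ ρ) x≡0 x∈ρ)) , s≤s⁻¹ (∈-upTo⁻ (∈-resp-↭ π↭ (∈-++⁺ˡ x∈ρ)))
    where
    x∈ρ : x ∈ ρ
    x∈ρ = subst (x ∈_) L-zero (L-antitone (≤⇒≤′ (z≤n {k})) x∈)
    0∉ρ : 0 ∉ ρ
    0∉ρ = proj₁ (Unique-++-∷⇒∉ ρ π-unique)

  column-of : ∀ {x} → x ∈[n] → ∃ λ k → x ∈ Cs k
  column-of x∈[n] = column-exists (length (L 0)) 0 ≤-refl (∈[n]⇒∈L0 x∈[n])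

  position-Cs : ∀ {x} k → x ∈ Cs k → col π x ≡ suc k × indexOf x (Cs k) ≡ just (colpos π x)
  position-Cs {x} k x∈ = cong proj₁ position≡ , trans x-at-j (cong just (sym (cong proj₂ position≡)))
    where
    j : ℕ
    j = proj₁ (indexOf-∈ (Cs k) x∈)
    x-at-j : indexOf x (Cs k) ≡ just j
    x-at-j = proj₁ (proj₂ (indexOf-∈ (Cs k) x∈))
    elsewhere : ∀ {i} → i ∈ range1 (sc π) → i ≢ suc k → indexOf x (C π i) ≡ nothing
    elsewhere i∈ i≢ with ∈-range1⁻ i∈
    ... | k′ , refl , _ = indexOf-∉ (Cs k′) (λ x∈′ → i≢ (cong suc (Cs-disjoint k′ k x∈′ x∈)))
    position≡ : position π x ≡ (suc k , j)
    position≡ = searchCols-≡ π x (range1 (sc π)) (∈-range1⁺ (s≤s z≤n) (L-nonempty⇒<sc k (Cs⊆L k x∈)))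
                  x-at-j elsewhere

  col-Cs : ∀ {x} k → x ∈ Cs k → col π x ≡ suc k
  col-Cs k x∈ = proj₁ (position-Cs k x∈)

  colpos-Cs : ∀ {x} k → x ∈ Cs k → indexOf x (Cs k) ≡ just (colpos π x)
  colpos-Cs k x∈ = proj₂ (position-Cs k x∈)

  -- x is a right-to-left maximum of L (suc k) = s(b₁) ⋯ s(b_m), hence the maximum of some b_j.
  leftof-block : ∀ {x} k → x ∈ Cs (suc k) → ∃ λ b → (b , leftof π x) ∈ D k × IsMaxOf x b
  leftof-block {x} k x∈ = subst (λ c → ∃ λ b → (b , c) ∈ D k × IsMaxOf x b) (sym leftof≡)
                            (leftofSearch-∈ (D k) (sortedBlocks-RLMax (D k) blocks-unique x-RLMax))
    where
    x-RLMax : RLMax x (sortedBlocks (D k))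
    x-RLMax = subst (RLMax x) (L-suc k) (Decomposition-RLMax (D-Decomposition (suc k)) x∈)
    blocks-unique : All (Unique ∘ proj₁) (D k)
    blocks-unique = Decomposition-Unique-blocks (D-Decomposition k) (L-unique k)
    leftof≡ : leftof π x ≡ leftofSearch x (D k)
    leftof≡ = cong (λ c → leftofSearch x (colData π (c ∸ 1))) (col-Cs (suc k) x∈)

  leftof-∈ : ∀ {x} k → x ∈ Cs (suc k) → leftof π x ∈ Cs k
  leftof-∈ k x∈ = ∈-map⁺ proj₂ (proj₁ (proj₂ (leftof-block k x∈)))

  row-Cs0 : ∀ {x} → x ∈ Cs 0 → row π x ≡ colpos π x
  row-Cs0 {x} x∈ = begin
    rowF π (col π x) x   ≡⟨ cong (λ c → rowF π c x) col≡1 ⟩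
    rowF π 1 x           ≡⟨ cong (λ c → if c ≤ᵇ 1 then colpos π x else rowF π 0 (leftof π x)) col≡1 ⟩
    colpos π x           ∎
    where
    open ≡-Reasoning
    col≡1 : col π x ≡ 1
    col≡1 = col-Cs 0 x∈

  row-leftof : ∀ {x} k → x ∈ Cs (suc k) → row π x ≡ row π (leftof π x)
  row-leftof {x} k x∈ = begin
    rowF π (col π x) x
      ≡⟨ cong (λ c → rowF π c x) col≡ ⟩
    rowF π (suc (suc k)) x
      ≡⟨ cong (λ c → if c ≤ᵇ 1 then colpos π x else rowF π (suc k) (leftof π x)) col≡ ⟩
    rowF π (suc k) (leftof π x)
      ≡⟨ cong (λ c → rowF π c (leftof π x)) (col-Cs k (leftof-∈ k x∈)) ⟨
    rowF π (col π (leftof π x)) (leftof π x)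
      ∎
    where
    open ≡-Reasoning
    col≡ : col π x ≡ suc (suc k)
    col≡ = col-Cs (suc k) x∈

  row-bounds : ∀ {x} k → x ∈ Cs k → 1 ≤ row π x × row π x ≤ length (Cs 0)
  row-bounds {x} zero x∈ with indexOf-∈ (Cs 0) x∈
  ... | j , x-at-j , bounds =
    subst (λ r → 1 ≤ r × r ≤ length (Cs 0))
          (trans (just-injective (trans (sym x-at-j) (colpos-Cs 0 x∈))) (sym (row-Cs0 x∈))) bounds
  row-bounds {x} (suc k) x∈ =
    subst (λ r → 1 ≤ r × r ≤ length (Cs 0)) (sym (row-leftof k x∈)) (row-bounds k (leftof-∈ k x∈))

  leftof-injective : ∀ {x y} k → x ∈ Cs (suc k) → y ∈ Cs (suc k) → leftof π x ≡ leftof π y → x ≡ y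
  leftof-injective {x} {y} k x∈ y∈ leftof≡ =
    let b  , b∈  , _ , maxb≡x  = leftof-block k x∈
        b′ , b′∈ , _ , maxb′≡y = leftof-block k y∈
        b≡b′ = Unique-map-proj₂⇒functional (Cs-unique k) b∈ (subst (λ c → (b′ , c) ∈ D k) (sym leftof≡) b′∈)
    in trans (sym maxb≡x) (trans (cong maxL b≡b′) maxb′≡y)

  row-injective : ∀ {x y} k → x ∈ Cs k → y ∈ Cs k → row π x ≡ row π y → x ≡ y
  row-injective zero x∈ y∈ row≡ =
    indexOf-injective (Cs 0) (colpos-Cs 0 x∈)
      (trans (colpos-Cs 0 y∈) (cong just (trans (sym (row-Cs0 y∈)) (trans (sym row≡) (row-Cs0 x∈)))))
  row-injective {x} {y} (suc k) x∈ y∈ row≡ =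
    leftof-injective k x∈ y∈ (row-injective k (leftof-∈ k x∈) (leftof-∈ k y∈) leftof-row≡)
    where
    leftof-row≡ : row π (leftof π x) ≡ row π (leftof π y)
    leftof-row≡ = trans (sym (row-leftof k x∈)) (trans row≡ (row-leftof k y∈))

  same-row-in-column : ∀ {x} k c → c ≤′ k → x ∈ Cs k → ∃ λ y → y ∈ Cs c × row π y ≡ row π x
  same-row-in-column {x} k       .k ≤′-refl         x∈ = x , x∈ , refl
  same-row-in-column {x} (suc k) c  (≤′-step c≤′k) x∈ =
    let y , y∈ , row≡ = same-row-in-column k c c≤′k (leftof-∈ k x∈)
    in y , y∈ , trans row≡ (sym (row-leftof k x∈))

  in-row? : ℕ → ℕ → Bool
  in-row? j x = row π x ≡ᵇ j

  Row : ℕ → List ℕ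
  Row j = filterᵇ (in-row? j) (range1 n)

  ∈Row⁺ : ∀ {x j} → x ∈[n] → row π x ≡ j → x ∈ Row j
  ∈Row⁺ {x} {j} (1≤x , x≤n) row≡ = ∈-filter⁺ (T? ∘ in-row? j) (∈-range1⁺ 1≤x x≤n) (≡⇒≡ᵇ (row π x) j row≡)

  ∈Row⁻ : ∀ {x j} → x ∈ Row j → x ∈[n] × row π x ≡ j
  ∈Row⁻ {x} {j} x∈ with ∈-filter⁻ (T? ∘ in-row? j) {xs = range1 n} x∈
  ... | x∈range , in-row with ∈-range1⁻ x∈range
  ...   | _ , refl , x≤n = (s≤s z≤n , x≤n) , ≡ᵇ⇒≡ (row π x) j in-row

  Row-unique : ∀ j → Unique (Row j)
  Row-unique j = Uniqueₚ.filter⁺ (T? ∘ in-row? j) (Unique-range1 n)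

  length-α : length (α n π) ≡ length (Cs 0)
  length-α = trans (length-map _ (range1 (length (Cs 0)))) (length-range1 _)

  α-at : ∀ {j} → 1 ≤ j → j ≤ length (Cs 0) → at (α n π) (j ∸ 1) ≡ length (Row j)
  α-at {suc j} _ j<|Cs0| = at-map-range1 (length ∘ Row) (length (Cs 0)) j<|Cs0|

  Tab-injective-∈ : ∀ {x y} → x ∈[n] → y ∈[n] → Tab π x ≡ Tab π y → x ≡ y
  Tab-injective-∈ {y = y} x∈[n] y∈[n] Tab≡ with column-of x∈[n] | column-of y∈[n]
  ... | k , x∈ | k′ , y∈ =
    row-injective k x∈ (subst (λ c → y ∈ Cs c) (sym k≡k′) y∈) (cong proj₂ Tab≡)
    where
    k≡k′ : k ≡ k′
    k≡k′ = suc-injective (trans (sym (col-Cs k x∈)) (trans (cong proj₁ Tab≡) (col-Cs k′ y∈)))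

  -- Following leftof from x meets every column to its left in row(x).
  col≤length-Row : ∀ {x} k → x ∈ Cs k → suc k ≤ length (Row (row π x))
  col≤length-Row {x} k x∈ = subst₂ _≤_ (length-range1 (suc k)) (length-map (col π) (Row (row π x)))
    (Unique-⊆⇒length-≤ (range1 (suc k)) (map (col π) (Row (row π x))) (Unique-range1 (suc k)) columns⊆)
    where
    columns⊆ : ∀ {c} → c ∈ range1 (suc k) → c ∈ map (col π) (Row (row π x))
    columns⊆ c∈ with ∈-range1⁻ c∈
    ... | c′ , refl , c′<sk with same-row-in-column k c′ (≤⇒≤′ (s≤s⁻¹ c′<sk)) x∈
    ...   | y , y∈ , row≡ =
      subst (_∈ map (col π) (Row (row π x))) (col-Cs c′ y∈)
        (∈-map⁺ (col π) (∈Row⁺ (∈L⇒∈[n] c′ (Cs⊆L c′ y∈)) row≡))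

  -- The columns met by row j are distinct and positive, so the largest is at least their number.
  tallest-in-row : ∀ j → 1 ≤ length (Row j) → ∃ λ y → y ∈ Row j × length (Row j) ≤ col π y
  tallest-in-row j 1≤|Row| = y , y∈ , subst (length (Row j) ≤_) maxL≡col
    (subst (_≤ maxL cols) (length-map (col π) (Row j)) (length≤maxL cols cols-unique cols-positive))
    where
    cols : List ℕ
    cols = map (col π) (Row j)
    cols-unique : Unique cols
    cols-unique = Unique-map⁺-on (col π) (λ a∈ b∈ col≡ →
      Tab-injective-∈ (proj₁ (∈Row⁻ a∈)) (proj₁ (∈Row⁻ b∈))
        (cong₂ _,_ col≡ (trans (proj₂ (∈Row⁻ a∈)) (sym (proj₂ (∈Row⁻ b∈)))))) (Row-unique j)
    cols-positive : All (1 ≤_) cols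
    cols-positive = All.map⁺ (All.tabulate λ a∈ →
      let k , a∈Cs = column-of (proj₁ (∈Row⁻ a∈)) in subst (1 ≤_) (sym (col-Cs k a∈Cs)) (s≤s z≤n))
    maxL∈ : maxL cols ∈ cols
    maxL∈ = maxL-∈′ cols (subst (1 ≤_) (sym (length-map (col π) (Row j))) 1≤|Row|)
    y : ℕ
    y = proj₁ (∈-map⁻ (col π) maxL∈)
    y∈ : y ∈ Row j
    y∈ = proj₁ (proj₂ (∈-map⁻ (col π) maxL∈))
    maxL≡col : maxL cols ≡ col π y
    maxL≡col = proj₂ (proj₂ (∈-map⁻ (col π) maxL∈))

  Tab-into : ∀ x → 1 ≤ x → x ≤ n → InD (α n π) (Tab π x)
  Tab-into x 1≤x x≤n =
    let k , x∈     = column-of (1≤x , x≤n)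
        1≤r , r≤   = row-bounds k x∈
    in subst (1 ≤_) (sym (col-Cs k x∈)) (s≤s z≤n) , 1≤r , subst (row π x ≤_) (sym length-α) r≤ ,
       subst₂ _≤_ (sym (col-Cs k x∈)) (sym (α-at 1≤r r≤)) (col≤length-Row k x∈)

  Tab-injective : ∀ x y → 1 ≤ x → x ≤ n → 1 ≤ y → y ≤ n → Tab π x ≡ Tab π y → x ≡ y
  Tab-injective x y 1≤x x≤n 1≤y y≤n = Tab-injective-∈ (1≤x , x≤n) (1≤y , y≤n)

  Tab-surjective : ∀ p → InD (α n π) p → ∃ λ x → 1 ≤ x × x ≤ n × Tab π x ≡ p
  Tab-surjective (zero  , j) (() , _)
  Tab-surjective (suc i , j) (_ , 1≤j , j≤|α| , si≤αj) =
    let y , y∈Row , |Row|≤col-y = tallest-in-row j (≤-trans (s≤s z≤n) si≤|Row|)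
        y∈[n] , row-y≡j    = ∈Row⁻ y∈Row
        k , y∈             = column-of y∈[n]
        i≤k                = s≤s⁻¹ (≤-trans si≤|Row| (subst (length (Row j) ≤_) (col-Cs k y∈) |Row|≤col-y))
        z , z∈ , row≡      = same-row-in-column k i (≤⇒≤′ i≤k) y∈
        z∈[n]              = ∈L⇒∈[n] i (Cs⊆L i z∈)
    in z , proj₁ z∈[n] , proj₂ z∈[n] , cong₂ _,_ (col-Cs i z∈) (trans row≡ row-y≡j)
    where
    si≤|Row| : suc i ≤ length (Row j)
    si≤|Row| = subst (suc i ≤_) (α-at 1≤j (subst (j ≤_) length-α j≤|α|)) si≤αj

corollary3p17 : (n : ℕ) (π : List ℕ) → InS' n π →
    -- T_π maps [n] into D(α_π)
    ((x : ℕ) → 1 ≤ x → x ≤ n → InD (α n π) (Tab π x))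
    -- injective on [n]
    × ((x y : ℕ) → 1 ≤ x → x ≤ n → 1 ≤ y → y ≤ n → Tab π x ≡ Tab π y → x ≡ y)
    -- surjective onto D(α_π)
    × ((p : ℕ × ℕ) → InD (α n π) p → ∃ λ x → 1 ≤ x × x ≤ n × Tab π x ≡ p)
corollary3p17 n .(ρ ++ [ 0 ]) (π↭ , ρ , refl) = Tab-into , Tab-injective , Tab-surjective
  where open StackSortingTableau n ρ π↭
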